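{- Assume $\mathfrak b=\mathfrak d$, and let $\langle f_\alpha:\alpha<\mathfrak d\rangle$ be a scale (a $\le^*$-increasing dominating family in ${}^\omega\omega$) such that (i) each $f_\alpha$ is strictly increasing and $f_\alpha(n)>0$ for all $n$, and (ii) for all $\beta<\alpha<\mathfrak d$ and all but finitely many $n$ there is $\ell$ with $f_\alpha(n)<f_\beta(\ell)<f_\beta(\ell+1)<f_\alpha(n+1)$. Then for every infinite $A\subseteq\omega$ there is $\alpha<\mathfrak d$ such that for all but finitely many $n$, \[ A\cap\big[f_\alpha^{\,n}(0),\,f_\alpha^{\,n+1}(0)\big)\neq\emptyset. \]
   Context: $f\le^* g$ means $f(n)\le g(n)$ for all but finitely many $n$. $\mathfrak b$ is the least size of a $\le^*$-unbounded family in ${}^\omega\omega$, $\mathfrak d$ the least size of a dominating family. $f^{\,n}$ denotes the $n$-th iterate of $f$ (with $f^{\,0}$ the identity), and $[a,b)=\{m\in\omega: a\le m<b\}$. -}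

module Defs where

open import Data.Nat using (ℕ; zero; suc; _≤_; _<_)
open import Data.Product using (Σ; ∃; _×_; _,_)
open import Relation.Nullary using (¬_)
open import Relation.Binary using (Rel; IsStrictTotalOrder)
open import Induction.WellFounded using (WellFounded)
open import Function.Bundles using (_↣_)
open import Level using (0ℓ)
open import Relation.Binary.PropositionalEquality using (_≡_)

Eventually : (ℕ → Set) → Set
Eventually P = Σ ℕ λ N → ∀ n → N ≤ n → P n

_≤*_ : (ℕ → ℕ) → (ℕ → ℕ) → Set
f ≤* g = Eventually λ n → f n ≤ g n

Unbounded : {J : Set} → (J → ℕ → ℕ) → Set
Unbounded {J} F = ¬ (Σ (ℕ → ℕ) λ g → ∀ j → F j ≤* g)

Dominating : {J : Set} → (J → ℕ → ℕ) → Set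
Dominating {J} F = ∀ (g : ℕ → ℕ) → Σ J λ j → g ≤* F j

-- |I| ≤ 𝔟 : every unbounded family has at least |I| members
CardBelow-𝔟 : Set → Set₁
CardBelow-𝔟 I = ∀ (J : Set) (F : J → ℕ → ℕ) → Unbounded F → I ↣ J

-- |I| ≤ 𝔡 : every dominating family has at least |I| members
CardBelow-𝔡 : Set → Set₁
CardBelow-𝔡 I = ∀ (J : Set) (F : J → ℕ → ℕ) → Dominating F → I ↣ J

Seg : {I : Set} → Rel I 0ℓ → I → Set
Seg {I} _≺_ α = Σ I λ β → β ≺ α

record InitialOrdinal (I : Set) (_≺_ : Rel I 0ℓ) : Set where
  field
    isSTO : IsStrictTotalOrder _≡_ _≺_
    wf    : WellFounded _≺_
    initial : ∀ α → ¬ (I ↣ Seg _≺_ α)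

iter : (ℕ → ℕ) → ℕ → ℕ → ℕ
iter f zero x = x
iter f (suc n) x = f (iter f n x)

StrictlyIncreasing : (ℕ → ℕ) → Set
StrictlyIncreasing f = ∀ m n → m < n → f m < f n

Infinite : (ℕ → Set) → Set
Infinite A = ∀ m → Σ ℕ λ k → m ≤ k × A k

-- Let g x be one more than some element of A above x. A single member f α of the dominating
-- family eventually dominates g; since f α is inflationary, the block starts f α ^ n 0 grow at
-- least like n, so for large n the element of A above f α ^ n 0 lies below f α (f α ^ n 0).
module Submission where

open import Defs
open import Data.Nat using (ℕ; zero; suc; _≤_; _<_; _+_; z≤n; s≤s)
open import Data.Nat.Properties using (≤-trans; <-≤-trans; n<1+n)
open import Data.Product using (Σ; _×_; _,_; proj₁)
open import Relation.Binary using (Rel)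
open import Level using (0ℓ)

Inflationary : (ℕ → ℕ) → Set
Inflationary g = ∀ x → x < g x

strictlyIncreasing⇒inflationary : ∀ {g} → StrictlyIncreasing g → 0 < g 0 → Inflationary g
strictlyIncreasing⇒inflationary g-inc g0>0 zero    = g0>0
strictlyIncreasing⇒inflationary g-inc g0>0 (suc x) =
  <-≤-trans (s≤s (strictlyIncreasing⇒inflationary g-inc g0>0 x)) (g-inc x (suc x) (n<1+n x))

inflationary⇒n≤iter : ∀ {g} → Inflationary g → ∀ n → n ≤ iter g n 0
inflationary⇒n≤iter g-infl zero    = z≤n
inflationary⇒n≤iter g-infl (suc n) = ≤-trans (s≤s (inflationary⇒n≤iter g-infl n)) (g-infl _)

eventually-∘ : ∀ {P : ℕ → Set} {h : ℕ → ℕ} → (∀ n → n ≤ h n) → Eventually P → Eventually (λ n → P (h n))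
eventually-∘ n≤h (N , p) = N , λ n N≤n → p _ (≤-trans N≤n (n≤h n))

module _ (A : ℕ → Set) (A-inf : Infinite A) where

  strictUpperBoundAbove : ℕ → ℕ
  strictUpperBoundAbove x = suc (proj₁ (A-inf x))

  meets-intervalTo : ∀ {g} → strictUpperBoundAbove ≤* g
                → Eventually λ x → Σ ℕ λ m → x ≤ m × m < g x × A m
  meets-intervalTo (N , bound) = N , λ x N≤x →
    let (m , x≤m , Am) = A-inf x in m , x≤m , bound x N≤x , Am

  meets-iterationBlocks : ∀ {g} → Inflationary g → strictUpperBoundAbove ≤* g
                        → Eventually λ n → Σ ℕ λ m → iter g n 0 ≤ m × m < iter g (suc n) 0 × A m
  meets-iterationBlocks g-infl bound =
    eventually-∘ (inflationary⇒n≤iter g-infl) (meets-intervalTo bound)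

lemma3p7 : (I : Set) (_≺_ : Rel I 0ℓ) → InitialOrdinal I _≺_
    → CardBelow-𝔡 I
    → CardBelow-𝔟 I
    → (f : I → ℕ → ℕ)
    → Dominating f
    → (∀ β α → β ≺ α → f β ≤* f α)
    → (∀ α → StrictlyIncreasing (f α))
    → (∀ α n → 0 < f α n)
    → (∀ β α → β ≺ α → Eventually λ n → Σ ℕ λ ℓ → f α n < f β ℓ × f β ℓ < f β (suc ℓ) × f β (suc ℓ) < f α (suc n))
    → (A : ℕ → Set) → Infinite A
    → Σ I λ α → Eventually λ n → Σ ℕ λ m → iter (f α) n 0 ≤ m × m < iter (f α) (suc n) 0 × A m
lemma3p7 I _≺_ _ _ _ f f-dom _ f-inc f-pos _ A A-inf =
  let (α , bound) = f-dom (strictUpperBoundAbove A A-inf)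
  in α , meets-iterationBlocks A A-inf (strictlyIncreasing⇒inflationary (f-inc α) (f-pos α 0)) bound
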